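{- For every finite linear order $Y$, $\mathsf{rk}(Y)=\lfloor\log_2(|Y|+1)\rfloor$. In particular, for $n\in\omega$, $\mathsf{rk}(Y)\ge n$ if and only if $|Y|\ge 2^n-1$.
   Context: Let $\mathcal F$ be the class of finite linear orders (language $\{<\}$). For a countable linear order $Y$, $\mathsf{age}(Y)$ is its set of finite suborders. If $A\le B$ and $|B\setminus A|=1$, $B$ is a prime extension of $A$. If $A\le B$, $A\le Y$, a realization of $B$ in $Y$ is some $C\le Y$ with $A\le C$ and an order isomorphism $B\to C$ fixing $A$ pointwise. For $F\in\mathsf{age}(Y)$: $\mathsf{rk}_Y(F)\ge 0$ always; $\mathsf{rk}_Y(F)\ge\alpha+1$ iff every prime extension $B$ of $F$ that is a finite linear order has a realization $C$ in $Y$ with $\mathsf{rk}_Y(C)\ge\alpha$; for limit $\alpha$, $\mathsf{rk}_Y(F)\ge\alpha$ iff $\mathsf{rk}_Y(F)\ge\beta$ for all $\beta<\alpha$; $\mathsf{rk}_Y(F)=\sup\{\alpha:\mathsf{rk}_Y(F)\ge\alpha\}$; $\mathsf{rk}(Y)=\mathsf{rk}_Y(\emptyset)$. -}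

module Defs where

open import Level using (Level; Lift) renaming (zero to ℓ0; suc to lsuc)
open import Data.Nat using (ℕ; zero; suc)
open import Data.Fin using (Fin)
open import Data.Fin.Subset using (Subset; _∈_; _∪_; ⁅_⁆; ⊥)
open import Data.Product using (Σ; _×_; _,_; proj₁)
open import Data.Sum using (_⊎_)
open import Data.Unit using (⊤)
open import Relation.Nullary using (¬_)
open import Relation.Binary.Core using (Rel)
open import Relation.Binary.Structures using (IsStrictTotalOrder)
open import Relation.Binary.PropositionalEquality using (_≡_)
open import Function.Bundles using (_⇔_)

-- A finite linear order Y with |Y| = m is given (up to relabelling of its
-- points) by a strict total order _<_ on the m-element set Fin m.
-- A finite suborder F ∈ age(Y) is a subset of Fin m with the induced order.

Elem : {m : ℕ} → Subset m → Set
Elem {m} F = Σ (Fin m) (λ x → x ∈ F)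

-- A prime extension B of F that is a finite linear order: an (abstract)
-- linear order B containing (an isomorphic copy of) F as a suborder, with
-- exactly one point outside F.
record PrimeExt {m : ℕ} (_<_ : Rel (Fin m) ℓ0) (F : Subset m) : Set₁ where
  field
    Carrier  : Set
    _<ᴮ_     : Rel Carrier ℓ0
    isSTO    : IsStrictTotalOrder _≡_ _<ᴮ_
    emb      : Elem F → Carrier
    emb-ord  : (x y : Elem F) → (proj₁ x < proj₁ y) ⇔ (emb x <ᴮ emb y)
    new      : Carrier
    new-fresh : (x : Elem F) → ¬ (emb x ≡ new)
    covers   : (b : Carrier) → (b ≡ new) ⊎ Σ (Elem F) (λ x → emb x ≡ b)

record Realization {m : ℕ} (_<_ : Rel (Fin m) ℓ0) (F : Subset m)
                   (B : PrimeExt _<_ F) : Set where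
  open PrimeExt B
  field
    g      : Carrier → Fin m
    g-ord  : (b c : Carrier) → (b <ᴮ c) ⇔ (g b < g c)
    g-fix  : (x : Elem F) → g (emb x) ≡ proj₁ x

  image : Subset m
  image = F ∪ ⁅ g new ⁆

-- rk_Y(F) ≥ n, for natural-number levels n.
RkGE : {m : ℕ} (_<_ : Rel (Fin m) ℓ0) → ℕ → Subset m → Set₁
RkGE _<_ zero    F = Lift (lsuc ℓ0) ⊤
RkGE _<_ (suc n) F =
  (B : PrimeExt _<_ F) →
  Σ (Realization _<_ F B) (λ r → RkGE _<_ n (Realization.image r))

RkYGE : {m : ℕ} (_<_ : Rel (Fin m) ℓ0) → ℕ → Set₁
RkYGE _<_ n = RkGE _<_ n ⊥

-- Number the points of Y as 1, …, m in increasing order (their ranks) and add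
-- the sentinels 0 and m + 1.  Then rk_Y(F) ≥ n holds exactly when every gap
-- of F, i.e. every open interval between consecutive numbers of F ∪ {0, m+1},
-- contains at least 2ⁿ − 1 points.  The induction step doubles: if every prime
-- extension of F is realized leaving all gaps ≥ K, then realizing the one
-- whose new point lies just above some point of F splits the gap there into
-- two gaps ≥ K, so it had ≥ 2K + 1 points; conversely, if all gaps have
-- ≥ 2K + 1 points, any prime extension is realized by the middle point of
-- the gap in which its new point falls.  For F = ∅ the only gap is Y itself,
-- so rk(Y) ≥ n iff m ≥ 2ⁿ − 1, whence rk(Y) = ⌊log₂(m + 1)⌋.
module Submission where

open import Defs
open import Level using (lift) renaming (zero to ℓ0)
open import Data.Nat using (ℕ; zero; suc; _+_; _*_; _∸_; _^_; _≤_; _<_; z≤n; s≤s; ⌊_/2⌋; ⌈_/2⌉)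
open import Data.Nat.Properties
open import Data.Nat.Logarithm using (⌊log₂_⌋; ⌊log₂⌋-mono-≤; ⌊log₂[2^n]⌋≡n)
open import Data.Nat.Logarithm.Core using (⌊log2⌋-acc-irrelevant)
open import Data.Nat.Induction using (<-wellFounded)
open import Induction.WellFounded using (Acc; acc)
open import Data.Fin using (Fin; zero; suc; fromℕ<; toℕ; punchOut) renaming (_≟_ to _≟ᶠ_)
open import Data.Fin.Properties using (any?; injective⇒≤; punchOut-injective; toℕ-fromℕ<; fromℕ<-injective)
open import Data.Fin.Subset using (Subset; _∈_; _∪_; ⁅_⁆; ⊥; ∣_∣)
open import Data.Fin.Subset.Properties using (_∈?_; ∈⊤; ∉⊥; ∣⊤∣≡n; p⊂q⇒∣p∣<∣q∣; x∈p∪q⁻; x∈p∪q⁺; x∈⁅x⁆; x∈⁅y⁆⇒x≡y)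
open import Data.Vec using (tabulate)
open import Data.Vec.Properties using (lookup∘tabulate; lookup⇒[]=; []=⇒lookup)
open import Data.Vec.Properties.WithK using ([]=-irrelevant)
open import Data.Bool.Properties using (T-≡)
open import Data.Maybe using (Maybe; just; nothing)
open import Data.Product using (Σ; _×_; _,_; proj₁; proj₂; ∃; map₂)
open import Data.Sum using (_⊎_; inj₁; inj₂)
open import Data.Unit using (tt)
open import Function using (_∘_; _on_)
open import Function.Bundles using (_⇔_; mk⇔; Equivalence)
open import Function.Definitions using (Injective)
import Function.Properties.Equivalence as ⇔
open import Relation.Nullary using (¬_; yes; no; isYes; contradiction)
open import Relation.Nullary.Decidable using (toWitness; fromWitness; map′)
open import Relation.Unary using (Pred; Decidable)
open import Relation.Binary.Core using (Rel)
open import Relation.Binary.Definitions using (Trichotomous; Tri; tri<; tri≈; tri>)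
open import Relation.Binary.Structures using (IsStrictPartialOrder; IsStrictTotalOrder)
open import Relation.Binary.PropositionalEquality

injective⇒surjective : ∀ {n} {f : Fin n → Fin n} → Injective _≡_ _≡_ f →
                       ∀ j → ∃ λ i → f i ≡ j
injective⇒surjective {suc n} {f} f-inj j with any? (λ i → f i ≟ᶠ j)
... | yes hit = hit
... | no miss = contradiction (injective⇒≤ punchOut∘f-injective) 1+n≰n
  where
  punchOut∘f : Fin (suc n) → Fin n
  punchOut∘f i = punchOut {i = j} {j = f i} (λ j≡fi → miss (i , sym j≡fi))

  punchOut∘f-injective : Injective _≡_ _≡_ punchOut∘f
  punchOut∘f-injective eq = f-inj (punchOut-injective {i = j} _ _ eq)

∃-maximum? : ∀ {n p} {P : Pred (Fin n) p} → Decidable P → (f : Fin n → ℕ) →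
             (∀ i → ¬ P i) ⊎ ∃ λ i → P i × (∀ j → P j → f j ≤ f i)
∃-maximum? {zero} P? f = inj₁ λ ()
∃-maximum? {suc n} P? f with ∃-maximum? (P? ∘ suc) (f ∘ suc) | P? zero
... | inj₁ none | no ¬p₀ = inj₁ λ { zero → ¬p₀ ; (suc i) → none i }
... | inj₁ none | yes p₀ =
  inj₂ (zero , p₀ , λ { zero _ → ≤-refl ; (suc j) pj → contradiction pj (none j) })
... | inj₂ (i , pᵢ , max) | no ¬p₀ =
  inj₂ (suc i , pᵢ , λ { zero p₀ → contradiction p₀ ¬p₀ ; (suc j) → max j })
... | inj₂ (i , pᵢ , max) | yes p₀ with f zero ≤? f (suc i)
...   | yes f₀≤fᵢ = inj₂ (suc i , pᵢ , λ { zero _ → f₀≤fᵢ ; (suc j) → max j })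
...   | no f₀≰fᵢ =
  inj₂ (zero , p₀ , λ { zero _ → ≤-refl ; (suc j) pj → ≤-trans (max j pj) (≰⇒≥ f₀≰fᵢ) })

2*⌊n/2⌋≤n : ∀ n → 2 * ⌊ n /2⌋ ≤ n
2*⌊n/2⌋≤n n = begin
  2 * ⌊ n /2⌋             ≡⟨ cong (⌊ n /2⌋ +_) (+-identityʳ ⌊ n /2⌋) ⟩
  ⌊ n /2⌋ + ⌊ n /2⌋       ≤⟨ +-monoʳ-≤ ⌊ n /2⌋ (⌊n/2⌋≤⌈n/2⌉ n) ⟩
  ⌊ n /2⌋ + ⌈ n /2⌉       ≡⟨ ⌊n/2⌋+⌈n/2⌉≡n n ⟩
  n                       ∎
  where open ≤-Reasoning

2^⌊log₂[1+n]⌋≤1+n : ∀ n → Acc _<_ n → 2 ^ ⌊log₂ (suc n) ⌋ ≤ suc n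
2^⌊log₂[1+n]⌋≤1+n zero    _        = ≤-refl
-- ⌊log₂ (2 + n)⌋ unfolds to suc (⌊log2⌋ (suc ⌊ n /2⌋) acc) for an accessibility
-- proof acc other than the one ⌊log₂_⌋ uses.
2^⌊log₂[1+n]⌋≤1+n (suc n) (acc rs) = begin
  2 ^ ⌊log₂ (2 + n) ⌋           ≡⟨ cong (λ l → 2 ^ suc l) (⌊log2⌋-acc-irrelevant (suc ⌊ n /2⌋)) ⟩
  2 * 2 ^ ⌊log₂ (suc ⌊ n /2⌋) ⌋ ≤⟨ *-monoʳ-≤ 2 (2^⌊log₂[1+n]⌋≤1+n ⌊ n /2⌋ (rs (s≤s (⌊n/2⌋≤n n)))) ⟩
  2 * suc ⌊ n /2⌋               ≡⟨ *-suc 2 ⌊ n /2⌋ ⟩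
  2 + 2 * ⌊ n /2⌋               ≤⟨ +-monoʳ-≤ 2 (2*⌊n/2⌋≤n n) ⟩
  2 + n                         ∎
  where open ≤-Reasoning

suc[2^n∸1]≡2^n : ∀ n → suc (2 ^ n ∸ 1) ≡ 2 ^ n
suc[2^n∸1]≡2^n n = suc-pred (2 ^ n) {{m^n≢0 2 n}}

2^n∸1≤m⇔2^n≤1+m : ∀ n m → 2 ^ n ∸ 1 ≤ m ⇔ 2 ^ n ≤ suc m
2^n∸1≤m⇔2^n≤1+m n m = mk⇔ (λ h → subst (_≤ suc m) (suc[2^n∸1]≡2^n n) (s≤s h))
                          (λ h → ≤-pred (subst (_≤ suc m) (sym (suc[2^n∸1]≡2^n n)) h))

2^[1+n]∸1≡1+2*[2^n∸1] : ∀ n → 2 ^ suc n ∸ 1 ≡ suc ((2 ^ n ∸ 1) + (2 ^ n ∸ 1))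
2^[1+n]∸1≡1+2*[2^n∸1] n = begin
  2 * 2 ^ n ∸ 1               ≡⟨ cong (λ t → 2 * t ∸ 1) (sym (suc[2^n∸1]≡2^n n)) ⟩
  2 * suc k ∸ 1               ≡⟨ cong (_∸ 1) (*-suc 2 k) ⟩
  suc (k + (k + 0))           ≡⟨ cong (λ j → suc (k + j)) (+-identityʳ k) ⟩
  suc (k + k)                 ∎
  where
  open ≡-Reasoning
  k = 2 ^ n ∸ 1

m+[1+n+n]≡[1+m+n]+n : ∀ m n → m + suc (n + n) ≡ suc (m + n) + n
m+[1+n+n]≡[1+m+n]+n m n = trans (+-suc m (n + n)) (cong suc (sym (+-assoc m n n)))

module _ {A B : Set} {_≈ᴬ_ _<ᴬ_ : Rel A ℓ0} {_<ᴮ_ : Rel B ℓ0}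
         (compare : Trichotomous _≈ᴬ_ _<ᴬ_) (B-spo : IsStrictPartialOrder _≡_ _<ᴮ_)
         {f : A → B} (f-mono : ∀ {x y} → x <ᴬ y → f x <ᴮ f y) where
  open IsStrictPartialOrder B-spo using (irrefl; asym)

  strictMono⇒injective : ∀ {x y} → f x ≡ f y → x ≈ᴬ y
  strictMono⇒injective {x} {y} fx≡fy with compare x y
  ... | tri< x<y _ _ = contradiction (f-mono x<y) (irrefl fx≡fy)
  ... | tri≈ _ x≈y _ = x≈y
  ... | tri> _ _ y<x = contradiction (f-mono y<x) (irrefl (sym fx≡fy))

  strictMono⇒reflects : (∀ {x y} → x ≈ᴬ y → f x ≡ f y) → ∀ {x y} → f x <ᴮ f y → x <ᴬ y
  strictMono⇒reflects f-cong {x} {y} fx<fy with compare x y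
  ... | tri< x<y _ _ = x<y
  ... | tri≈ _ x≈y _ = contradiction fx<fy (irrefl (f-cong x≈y))
  ... | tri> _ _ y<x = contradiction (f-mono y<x) (asym fx<fy)

<-on-injection-isStrictTotalOrder : ∀ {A : Set} (h : A → ℕ) → Injective _≡_ _≡_ h →
                                    IsStrictTotalOrder _≡_ (_<_ on h)
<-on-injection-isStrictTotalOrder h h-inj = record
  { isStrictPartialOrder = record
    { isEquivalence = isEquivalence
    ; irrefl        = λ { refl → <-irrefl refl }
    ; trans         = <-trans
    ; <-resp-≈      = (λ { refl hx<hy → hx<hy }) , (λ { refl hx<hy → hx<hy })
    }
  ; compare = compare
  }
  where
  compare : ∀ x y → Tri (h x < h y) (x ≡ y) (h y < h x)
  compare x y with <-cmp (h x) (h y)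
  ... | tri< lt ¬eq ¬gt = tri< lt (¬eq ∘ cong h) ¬gt
  ... | tri≈ ¬lt eq ¬gt = tri≈ ¬lt (h-inj eq) ¬gt
  ... | tri> ¬lt ¬eq gt = tri> ¬lt (¬eq ∘ cong h) gt

Elem-≡ : ∀ {m} {S : Subset m} {u v : Elem S} → proj₁ u ≡ proj₁ v → u ≡ v
Elem-≡ {u = x , x∈} {v = .x , x∈′} refl = cong (x ,_) ([]=-irrelevant x∈ x∈′)

module _ {m : ℕ} {_≺_ : Rel (Fin m) ℓ0} (sto : IsStrictTotalOrder _≡_ _≺_) where
  open IsStrictTotalOrder sto using (compare; irrefl; isStrictPartialOrder) renaming (trans to ≺-trans; _<?_ to _≺?_)

  below : Fin m → Subset m
  below y = tabulate (λ x → isYes (x ≺? y))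

  ∈-below⁺ : ∀ {x y} → x ≺ y → x ∈ below y
  ∈-below⁺ {x} {y} x≺y =
    lookup⇒[]= x _ (trans (lookup∘tabulate _ x) (Equivalence.to T-≡ (fromWitness {a? = x ≺? y} x≺y)))

  ∈-below⁻ : ∀ {x y} → x ∈ below y → x ≺ y
  ∈-below⁻ {x} {y} x∈ =
    toWitness {a? = x ≺? y} (Equivalence.from T-≡ (trans (sym (lookup∘tabulate _ x)) ([]=⇒lookup x∈)))

  rank : Fin m → ℕ
  rank y = ∣ below y ∣

  rank-mono : ∀ {x y} → x ≺ y → rank x < rank y
  rank-mono {x} x≺y = p⊂q⇒∣p∣<∣q∣
    ( (λ z∈ → ∈-below⁺ (≺-trans (∈-below⁻ z∈) x≺y))
    , x , ∈-below⁺ x≺y , irrefl refl ∘ ∈-below⁻ )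

  rank<m : ∀ y → rank y < m
  rank<m y = subst (rank y <_) (∣⊤∣≡n m)
    (p⊂q⇒∣p∣<∣q∣ ((λ _ → ∈⊤) , y , ∈⊤ , irrefl refl ∘ ∈-below⁻))

  rank-reflects : ∀ {x y} → rank x < rank y → x ≺ y
  rank-reflects = strictMono⇒reflects compare <-isStrictPartialOrder rank-mono (cong rank)

  rank-injective : Injective _≡_ _≡_ rank
  rank-injective = strictMono⇒injective compare <-isStrictPartialOrder rank-mono

  rank-surjective : ∀ {c} → c < m → ∃ λ y → rank y ≡ c
  rank-surjective {c} c<m = map₂ rank≡c (injective⇒surjective finRank-injective (fromℕ< c<m))
    where
    open ≡-Reasoning

    finRank : Fin m → Fin m
    finRank y = fromℕ< (rank<m y)

    finRank-injective : Injective _≡_ _≡_ finRank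
    finRank-injective eq = rank-injective (fromℕ<-injective _ _ (rank<m _) (rank<m _) eq)

    rank≡c : ∀ {y} → finRank y ≡ fromℕ< c<m → rank y ≡ c
    rank≡c {y} eq = begin
      rank y            ≡⟨ sym (toℕ-fromℕ< (rank<m y)) ⟩
      toℕ (finRank y)   ≡⟨ cong toℕ eq ⟩
      toℕ (fromℕ< c<m)  ≡⟨ toℕ-fromℕ< c<m ⟩
      c                 ∎

  -- The marks of S are the positions 1 + rank y of its points together with
  -- the sentinels 0 and m + 1, so that the gaps of S, including the two end
  -- gaps, are the open intervals between consecutive marks; Spaced k S says
  -- that each of them contains at least k points of Y.
  data Mark (S : Subset m) : ℕ → Set where
    bottom : Mark S 0
    top    : Mark S (suc m)
    point  : ∀ {y} → y ∈ S → Mark S (suc (rank y))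

  Spaced : ℕ → Subset m → Set
  Spaced k S = ∀ {a b} → Mark S a → Mark S b → a < b → a + k < b

  mark≤1+m : ∀ {S a} → Mark S a → a ≤ suc m
  mark≤1+m bottom    = z≤n
  mark≤1+m top       = ≤-refl
  mark≤1+m (point {y} _) = s≤s (<⇒≤ (rank<m y))

  mark-∪⁺ : ∀ {S p a} → Mark S a → Mark (S ∪ ⁅ p ⁆) a
  mark-∪⁺ bottom     = bottom
  mark-∪⁺ top        = top
  mark-∪⁺ (point y∈) = point (x∈p∪q⁺ (inj₁ y∈))

  mark-new : ∀ {S p} → Mark (S ∪ ⁅ p ⁆) (suc (rank p))
  mark-new {p = p} = point (x∈p∪q⁺ (inj₂ (x∈⁅x⁆ p)))

  mark-∪⁻ : ∀ {S p a} → Mark (S ∪ ⁅ p ⁆) a → Mark S a ⊎ a ≡ suc (rank p)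
  mark-∪⁻ bottom = inj₁ bottom
  mark-∪⁻ top    = inj₁ top
  mark-∪⁻ {S} {p} (point {y} y∈) with x∈p∪q⁻ S ⁅ p ⁆ y∈
  ... | inj₁ y∈S = inj₁ (point y∈S)
  ... | inj₂ y∈p = inj₂ (cong (suc ∘ rank) (x∈⁅y⁆⇒x≡y p y∈p))

  spaced-zero : ∀ {S} → Spaced 0 S
  spaced-zero {a = a} _ _ a<b = subst (_< _) (sym (+-identityʳ a)) a<b

  spaced-weaken : ∀ {k l S} → k ≤ l → Spaced l S → Spaced k S
  spaced-weaken k≤l spaced {a} ma mb a<b = ≤-<-trans (+-monoʳ-≤ a k≤l) (spaced ma mb a<b)

  spaced-∅⇔ : ∀ {k} → Spaced k ⊥ ⇔ k ≤ m
  spaced-∅⇔ = mk⇔ (λ spaced → ≤-pred (spaced bottom top (s≤s z≤n))) spaced-∅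
    where
    spaced-∅ : ∀ {k} → k ≤ m → Spaced k ⊥
    spaced-∅ k≤m bottom     top        _       = s≤s k≤m
    spaced-∅ _   (point y∈) _          _       = contradiction y∈ ∉⊥
    spaced-∅ _   _          (point y∈) _       = contradiction y∈ ∉⊥
    spaced-∅ _   bottom     bottom     ()
    spaced-∅ _   top        bottom     ()
    spaced-∅ _   top        top        1+m<1+m = contradiction 1+m<1+m (<-irrefl refl)

  spaced-gap : ∀ {k S a c} → Spaced k S → Mark S a → Mark S c → c ≤ a ⊎ a + k < c
  spaced-gap {a = a} {c} spaced ma mc with c ≤? a
  ... | yes c≤a = inj₁ c≤a
  ... | no  c≰a = inj₂ (spaced ma mc (≰⇒> c≰a))

  far-from-marks : ∀ {K S a p c} → Spaced (suc (K + K)) S → Mark S a → rank p ≡ a + K →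
                   Mark S c → c + K < suc (rank p) ⊎ suc (rank p) + K < c
  far-from-marks {K} {a = a} {c = c} spaced ma rank-p mc with spaced-gap spaced ma mc
  ... | inj₁ c≤a       = inj₁ (s≤s (subst (c + K ≤_) (sym rank-p) (+-monoˡ-≤ K c≤a)))
  ... | inj₂ a+1+2K<c  =
    inj₂ (subst (λ t → suc t + K < c) (sym rank-p) (subst (_< c) (m+[1+n+n]≡[1+m+n]+n a K) a+1+2K<c))

  spaced-insert : ∀ {K S a p} → Spaced (suc (K + K)) S → Mark S a → rank p ≡ a + K →
                  Spaced K (S ∪ ⁅ p ⁆)
  spaced-insert {K} spaced ma rank-p mc md c<d with mark-∪⁻ mc | mark-∪⁻ md
  ... | inj₁ mc′ | inj₁ md′ = spaced-weaken (m≤n⇒m≤1+n (m≤m+n K K)) spaced mc′ md′ c<d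
  ... | inj₁ mc′ | inj₂ refl with far-from-marks spaced ma rank-p mc′
  ...   | inj₁ c+K<p = c+K<p
  ...   | inj₂ p+K<c = contradiction c<d (<-asym (≤-<-trans (m≤m+n _ K) p+K<c))
  spaced-insert {K} spaced ma rank-p mc md c<d | inj₂ refl | inj₁ md′
    with far-from-marks spaced ma rank-p md′
  ...   | inj₁ d+K<p = contradiction c<d (<-asym (≤-<-trans (m≤m+n _ K) d+K<p))
  ...   | inj₂ p+K<d = p+K<d
  spaced-insert spaced ma rank-p mc md c<d | inj₂ refl | inj₂ refl = contradiction c<d (<-irrefl refl)

  module _ {S : Subset m} {B : PrimeExt _≺_ S} (R : Realization _≺_ S B) where
    open PrimeExt B
    open Realization R

    realized-below : ∀ x → emb x <ᴮ new → proj₁ x ≺ g new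
    realized-below x x<new = subst (_≺ g new) (g-fix x) (Equivalence.to (g-ord (emb x) new) x<new)

    realized-above : ∀ x → new <ᴮ emb x → g new ≺ proj₁ x
    realized-above x new<x = subst (g new ≺_) (g-fix x) (Equivalence.to (g-ord new (emb x)) new<x)

  -- The new point sits at the odd height 2a + 1 and each point of S at the
  -- even height 2 · (its mark), so new lies just above the mark a.
  module _ (S : Subset m) (a : ℕ) where
    height : Maybe (Elem S) → ℕ
    height nothing        = suc (2 * a)
    height (just (y , _)) = 2 * suc (rank y)

    height-injective : Injective _≡_ _≡_ height
    height-injective {nothing} {nothing} _ = refl
    height-injective {nothing} {just (y , _)} eq = contradiction (sym eq) (even≢odd (suc (rank y)) a)
    height-injective {just (x , _)} {nothing} eq = contradiction eq (even≢odd (suc (rank x)) a)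
    height-injective {just (x , _)} {just (y , _)} eq =
      cong just (Elem-≡ (rank-injective (suc-injective (*-cancelˡ-≡ _ _ 2 eq))))

    extensionAbove : PrimeExt _≺_ S
    extensionAbove = record
      { Carrier   = Maybe (Elem S)
      ; _<ᴮ_      = _<_ on height
      ; isSTO     = <-on-injection-isStrictTotalOrder height height-injective
      ; emb       = just
      ; emb-ord   = λ _ _ → mk⇔ (*-monoʳ-< 2 ∘ s≤s ∘ rank-mono)
                                 (rank-reflects ∘ ≤-pred ∘ *-cancelˡ-< 2 _ _)
      ; new       = nothing
      ; new-fresh = λ _ ()
      ; covers    = λ { nothing → inj₁ refl ; (just x) → inj₂ (x , refl) }
      }

    ≤cut⇒below-new : ∀ x → suc (rank (proj₁ x)) ≤ a → height (just x) < height nothing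
    ≤cut⇒below-new x x≤a = s≤s (*-monoʳ-≤ 2 x≤a)

    cut<⇒above-new : ∀ x → a < suc (rank (proj₁ x)) → height nothing < height (just x)
    cut<⇒above-new x a<x = subst (_≤ height (just x)) (*-suc 2 a) (*-monoʳ-≤ 2 a<x)

  module _ {S : Subset m} {a : ℕ} (R : Realization _≺_ S (extensionAbove S a)) where
    open Realization R using (g)

    new-above-cut : ∀ {c} → Mark S c → c ≤ a → c < suc m → c < suc (rank (g nothing))
    new-above-cut bottom       _   _       = s≤s z≤n
    new-above-cut top          _   1+m<1+m = contradiction 1+m<1+m (<-irrefl refl)
    new-above-cut (point y∈) y≤a _ =
      s≤s (rank-mono (realized-below R (_ , y∈) (≤cut⇒below-new S a (_ , y∈) y≤a)))

    new-below-cut : ∀ {c} → Mark S c → a < c → suc (rank (g nothing)) < c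
    new-below-cut bottom     a<0 = contradiction a<0 n≮0
    new-below-cut top        _   = s≤s (rank<m (g nothing))
    new-below-cut (point y∈) a<y =
      s≤s (rank-mono (realized-above R (_ , y∈) (cut<⇒above-new S a (_ , y∈) a<y)))

  spaced-double : ∀ {K S} →
                  (∀ B → Σ (Realization _≺_ S B) (λ R → Spaced K (Realization.image R))) →
                  Spaced (suc (K + K)) S
  spaced-double {K} {S} realize {a} {b} ma mb a<b = begin-strict
    a + suc (K + K)  ≡⟨ m+[1+n+n]≡[1+m+n]+n a K ⟩
    suc (a + K) + K  ≤⟨ +-monoˡ-≤ K (spaced (mark-∪⁺ ma) mark-new a<p) ⟩
    suc (rank p) + K <⟨ spaced mark-new (mark-∪⁺ mb) (new-below-cut R mb a<b) ⟩
    b                ∎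
    where
    open ≤-Reasoning
    R : Realization _≺_ S (extensionAbove S a)
    R = proj₁ (realize (extensionAbove S a))

    spaced : Spaced K (Realization.image R)
    spaced = proj₂ (realize (extensionAbove S a))

    p : Fin m
    p = Realization.g R nothing

    a<p : a < suc (rank p)
    a<p = new-above-cut R ma ≤-refl (<-≤-trans a<b (mark≤1+m mb))

  module _ {S : Subset m} (B : PrimeExt _≺_ S) where
    open PrimeExt B
    open IsStrictTotalOrder isSTO using () renaming
      (compare to compareᴮ; irrefl to irreflᴮ; trans to transᴮ; _<?_ to _<ᴮ?_; isStrictPartialOrder to spoᴮ)

    emb-mono : ∀ {x y} → proj₁ x ≺ proj₁ y → emb x <ᴮ emb y
    emb-mono {x} {y} = Equivalence.to (emb-ord x y)

    emb-reflects : ∀ {x y} → emb x <ᴮ emb y → proj₁ x ≺ proj₁ y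
    emb-reflects {x} {y} = Equivalence.from (emb-ord x y)

    emb-injective : ∀ {x y} → emb x ≡ emb y → proj₁ x ≡ proj₁ y
    emb-injective = strictMono⇒injective {_≈ᴬ_ = _≡_ on proj₁} {_<ᴬ_ = _≺_ on proj₁}
      (λ x y → compare (proj₁ x) (proj₁ y)) spoᴮ
      (λ {x} {y} → emb-mono {x} {y})

    module _ (p : Fin m) (below-p : ∀ x → emb x <ᴮ new → proj₁ x ≺ p)
             (above-p : ∀ x → new <ᴮ emb x → p ≺ proj₁ x) where
      place : ∀ {b} → (b ≡ new) ⊎ Σ (Elem S) (λ x → emb x ≡ b) → Fin m
      place (inj₁ _)       = p
      place (inj₂ (x , _)) = proj₁ x

      g : Carrier → Fin m
      g b = place (covers b)

      g-new : g new ≡ p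
      g-new with covers new
      ... | inj₁ _         = refl
      ... | inj₂ (x , x≡new) = contradiction x≡new (new-fresh x)

      g-fix : ∀ x → g (emb x) ≡ proj₁ x
      g-fix x with covers (emb x)
      ... | inj₁ x≡new      = contradiction x≡new (new-fresh x)
      ... | inj₂ (x′ , x′≡x) = emb-injective x′≡x

      g-mono : ∀ {b c} → b <ᴮ c → g b ≺ g c
      g-mono {b} {c} b<c with covers b | covers c
      ... | inj₁ refl       | inj₁ refl       = contradiction b<c (irreflᴮ refl)
      ... | inj₁ refl       | inj₂ (y , refl) = above-p y b<c
      ... | inj₂ (x , refl) | inj₁ refl       = below-p x b<c
      ... | inj₂ (x , refl) | inj₂ (y , refl) = emb-reflects b<c

      realization-at : Σ (Realization _≺_ S B) (λ R → Realization.g R new ≡ p)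
      realization-at = record
        { g     = g
        ; g-ord = λ b c → mk⇔ g-mono
                    (strictMono⇒reflects compareᴮ isStrictPartialOrder g-mono (cong g))
        ; g-fix = g-fix
        } , g-new

    record LowerCut : Set where
      field
        lower      : ℕ
        lower-mark : Mark S lower
        lower<1+m  : lower < suc m
        below⇒≤    : ∀ x → emb x <ᴮ new → suc (rank (proj₁ x)) ≤ lower
        above⇒>    : ∀ x → new <ᴮ emb x → lower < suc (rank (proj₁ x))

    below-new? : Decidable (λ x → Σ (x ∈ S) λ x∈ → emb (x , x∈) <ᴮ new)
    below-new? x with x ∈? S
    ... | no x∉  = no (x∉ ∘ proj₁)
    ... | yes x∈ = map′ (x∈ ,_) (λ (x∈′ , x<new) → subst (λ u → emb u <ᴮ new) (Elem-≡ refl) x<new)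
                        (emb (x , x∈) <ᴮ? new)

    lowerCut : LowerCut
    lowerCut with ∃-maximum? below-new? rank
    ... | inj₁ none = record
      { lower      = 0
      ; lower-mark = bottom
      ; lower<1+m  = s≤s z≤n
      ; below⇒≤    = λ (x , x∈) x<new → contradiction (x∈ , x<new) (none x)
      ; above⇒>    = λ _ _ → s≤s z≤n
      }
    ... | inj₂ (x₀ , (x₀∈ , x₀<new) , max) = record
      { lower      = suc (rank x₀)
      ; lower-mark = point x₀∈
      ; lower<1+m  = s≤s (rank<m x₀)
      ; below⇒≤    = λ (x , x∈) x<new → s≤s (max x (x∈ , x<new))
      ; above⇒>    = λ x new<x → s≤s (rank-mono (emb-reflects (transᴮ x₀<new new<x)))
      }

  spaced-halve : ∀ {K S} → Spaced (suc (K + K)) S → (B : PrimeExt _≺_ S) →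
                 Σ (Realization _≺_ S B) (λ R → Spaced K (Realization.image R))
  spaced-halve {K} {S} spaced B =
    R , subst (λ q → Spaced K (S ∪ ⁅ q ⁆)) (sym g-new≡p) (spaced-insert spaced lower-mark rank-p)
    where
    open PrimeExt B using (emb; new; _<ᴮ_)
    open LowerCut (lowerCut B)

    lower+K<lower+1+2K : lower + K < lower + suc (K + K)
    lower+K<lower+1+2K = +-monoʳ-< lower (s≤s (m≤m+n K K))

    lower+K<m : lower + K < m
    lower+K<m = ≤-pred (≤-<-trans lower+K<lower+1+2K (spaced lower-mark top lower<1+m))

    p : Fin m
    p = proj₁ (rank-surjective lower+K<m)

    rank-p : rank p ≡ lower + K
    rank-p = proj₂ (rank-surjective lower+K<m)

    below-p : ∀ x → emb x <ᴮ new → proj₁ x ≺ p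
    below-p x x<new =
      rank-reflects (subst (rank (proj₁ x) <_) (sym rank-p) (≤-trans (below⇒≤ x x<new) (m≤m+n lower K)))

    above-p : ∀ x → new <ᴮ emb x → p ≺ proj₁ x
    above-p x new<x = rank-reflects (subst (_< rank (proj₁ x)) (sym rank-p)
      (≤-pred (≤-<-trans lower+K<lower+1+2K (spaced lower-mark (point (proj₂ x)) (above⇒> x new<x)))))

    R : Realization _≺_ S B
    R = proj₁ (realization-at B p below-p above-p)

    g-new≡p : Realization.g R new ≡ p
    g-new≡p = proj₂ (realization-at B p below-p above-p)

  rk⇔spaced : ∀ n S → RkGE _≺_ n S ⇔ Spaced (2 ^ n ∸ 1) S
  rk⇔spaced zero    S = mk⇔ (λ _ {_} {_} → spaced-zero) (λ _ → lift tt)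
  rk⇔spaced (suc n) S = mk⇔ rk⇒spaced spaced⇒rk
    where
    2^[1+n]∸1≡ : 2 ^ suc n ∸ 1 ≡ suc ((2 ^ n ∸ 1) + (2 ^ n ∸ 1))
    2^[1+n]∸1≡ = 2^[1+n]∸1≡1+2*[2^n∸1] n

    rk⇒spaced : RkGE _≺_ (suc n) S → Spaced (2 ^ suc n ∸ 1) S
    rk⇒spaced rk = spaced-weaken (≤-reflexive 2^[1+n]∸1≡)
      (spaced-double (λ B → map₂ (Equivalence.to (rk⇔spaced n _)) (rk B)))

    spaced⇒rk : Spaced (2 ^ suc n ∸ 1) S → RkGE _≺_ (suc n) S
    spaced⇒rk spaced B = map₂ (Equivalence.from (rk⇔spaced n _))
      (spaced-halve (spaced-weaken (≤-reflexive (sym 2^[1+n]∸1≡)) spaced) B)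

  rk≥⇔2^n∸1≤m : ∀ n → RkYGE _≺_ n ⇔ (2 ^ n ∸ 1 ≤ m)
  rk≥⇔2^n∸1≤m n = ⇔.trans (rk⇔spaced n ⊥) spaced-∅⇔

theorem6p4 : (m : ℕ) (_<_ : Rel (Fin m) ℓ0) → IsStrictTotalOrder _≡_ _<_ →
    (RkYGE _<_ ⌊log₂ (m + 1) ⌋ × ¬ RkYGE _<_ (suc ⌊log₂ (m + 1) ⌋))
    × ((n : ℕ) → RkYGE _<_ n ⇔ (2 ^ n ∸ 1 ≤ m))
theorem6p4 m _<_ sto = (rk-attained , rk-not-exceeded) , rk≥⇔2^n∸1≤m sto
  where
  L : ℕ
  L = ⌊log₂ (m + 1) ⌋

  2^L≤1+m : 2 ^ L ≤ suc m
  2^L≤1+m = subst (λ t → 2 ^ ⌊log₂ t ⌋ ≤ suc m) (+-comm 1 m) (2^⌊log₂[1+n]⌋≤1+n m (<-wellFounded m))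

  rk-attained : RkYGE _<_ L
  rk-attained = Equivalence.from (rk≥⇔2^n∸1≤m sto L) (Equivalence.from (2^n∸1≤m⇔2^n≤1+m L m) 2^L≤1+m)

  rk-not-exceeded : ¬ RkYGE _<_ (suc L)
  rk-not-exceeded rk = 1+n≰n (begin
    suc L                   ≡⟨ sym (⌊log₂[2^n]⌋≡n (suc L)) ⟩
    ⌊log₂ (2 ^ suc L) ⌋     ≤⟨ ⌊log₂⌋-mono-≤ 2^[1+L]≤1+m ⟩
    ⌊log₂ (suc m) ⌋         ≡⟨ cong ⌊log₂_⌋ (+-comm 1 m) ⟩
    L                       ∎)
    where
    open ≤-Reasoning
    2^[1+L]≤1+m : 2 ^ suc L ≤ suc m
    2^[1+L]≤1+m = Equivalence.to (2^n∸1≤m⇔2^n≤1+m (suc L) m) (Equivalence.to (rk≥⇔2^n∸1≤m sto (suc L)) rk)
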